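{- Let $\ell\geq 2$ and let $n_1,\dots,n_\ell$ be positive integers. Let $G$ be the xor-product of the complete graphs $K_{n_1},\dots,K_{n_\ell}$. Then the clique number satisfies $$\omega(G) \leq n_1+n_2+\cdots+n_\ell - \ell + 1.$$
   Context: The xor-product $G_1 \cdots G_\ell$ of graphs has vertex set $V(G_1)\times\cdots\times V(G_\ell)$, and two distinct vertices $(g_1,\dots,g_\ell)$, $(g_1',\dots,g_\ell')$ are adjacent iff $g_ig_i'\in E(G_i)$ for an odd number of indices $i$ (in a complete graph, $g_ig_i'$ is an edge iff $g_i\neq g_i'$). -}

module Defs where

open import Data.Nat using (ℕ; zero; suc; _+_; _∸_; _≤_)
open import Data.Nat.Base using (_%_)
open import Data.Fin using (Fin; zero; suc)
open import Data.List using (List; length)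
open import Data.List.Relation.Unary.AllPairs using (AllPairs)
open import Relation.Binary.PropositionalEquality using (_≡_)
open import Relation.Nullary using (¬_; does)
open import Data.Bool using (if_then_else_)
open import Data.Fin.Properties using (_≟_)

Vertex : (ℓ : ℕ) → (Fin ℓ → ℕ) → Set
Vertex ℓ n = (i : Fin ℓ) → Fin (n i)

diffCount : (ℓ : ℕ) (n : Fin ℓ → ℕ) → Vertex ℓ n → Vertex ℓ n → ℕ
diffCount zero    n g h = 0
diffCount (suc ℓ) n g h =
  (if does (g zero ≟ h zero) then 0 else 1)
  + diffCount ℓ (λ i → n (suc i)) (λ i → g (suc i)) (λ i → h (suc i))

-- (odd number of differing coordinates) adjacency in the xor-product of complete graphs (for distinct vertices)
XorAdj : (ℓ : ℕ) (n : Fin ℓ → ℕ) → Vertex ℓ n → Vertex ℓ n → Set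
XorAdj ℓ n g h = diffCount ℓ n g h % 2 ≡ 1

IsClique : (ℓ : ℕ) (n : Fin ℓ → ℕ) → List (Vertex ℓ n) → Set
IsClique ℓ n xs = AllPairs (λ g h → ¬ (g ≡ h) × XorAdj ℓ n g h) xs
  where open import Data.Product using (_×_)

sumFin : (ℓ : ℕ) → (Fin ℓ → ℕ) → ℕ
sumFin zero    n = 0
sumFin (suc ℓ) n = n zero + sumFin ℓ (λ i → n (suc i))

-- Work over 𝔽₂ (Data.Parity, where p ⁻¹ = 1 + p). The adjacency of the xor-product
-- is the parity of the number of differing coordinates, i.e. the sum over i of the kernels
-- [gᵢ ≢ hᵢ]. Each of these has the form c(a) + ⟨u(a), v(b)⟩ with u, v valued in 𝔽₂^(nᵢ-1), so
-- the adjacency has this form with u, v valued in 𝔽₂^d, d = Σ (nᵢ - 1). On a clique x₁ … xₘ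
-- the adjacency is 1 + δⱼₖ, so the vectors (1 + c(xⱼ), u(xⱼ)) and (1, v(xₖ)) of 𝔽₂^(d+1)
-- form a biorthogonal system, whence m ≤ d + 1: the map c ↦ Σₖ cₖ (1, v(xₖ)) is injective
-- 𝔽₂^m → 𝔽₂^(d+1), and 2^m ≤ 2^(d+1).
{-# OPTIONS --safe #-}
module Submission where

open import Defs
open import Data.Nat using (ℕ; zero; suc; _+_; _∸_; _≤_; _≥_; _<_; z≤n; s≤s; _^_; _%_; parity)
open import Data.Nat.Properties using (≮⇒≥; <⇒≱; ^-monoʳ-<; m+n∸n≡m; m∸n+n≡m; +-comm; +-assoc; +-suc)
open import Data.Parity.Base using (Parity; 0ℙ; 1ℙ; _⁻¹) renaming (_+_ to infixl 6 _⊕_; _*_ to _·_)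
import Data.Parity.Properties as ℙ
open import Algebra.Properties.Semiring.Sum ℙ.+-*-semiring using (sum; sum-syntax; sum-cong-≗; ∑-comm; *-distribˡ-sum; *-distribʳ-sum; sum-replicate-zero)
open import Algebra.Properties.CommutativeSemigroup ℙ.+-commutativeSemigroup using (interchange)
open import Data.Fin using (Fin; zero; suc; _↑ˡ_; _↑ʳ_; funToFin; finToFun; combine)
open import Data.Fin.Properties using (_≟_; injective⇒≤; funToFin-finToFin; finToFun-funToFin)
open import Data.Vec.Functional using (Vector; []; _∷_; _++_)
open import Data.Vec.Functional.Properties using (lookup-++ˡ; lookup-++ʳ)
open import Data.List using (List; length; lookup)
import Data.List.Relation.Unary.All as All
open import Data.List.Relation.Unary.AllPairs as AllPairs using (AllPairs)
open import Data.List.Membership.Propositional.Properties using (∈-lookup)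
open import Data.Bool using (Bool; true; false; if_then_else_)
open import Data.Product using (_,_)
open import Level using (0ℓ)
open import Function using (_∘_; _↔_; Inverse; mk↔ₛ′; mk⇔; Injective)
open import Relation.Binary using (Rel; Symmetric)
open import Relation.Binary.PropositionalEquality
open import Relation.Nullary using (does; yes; no; ¬_; contradiction)
open import Relation.Nullary.Decidable using (dec-true; does-⇔)

private variable
  k m d d₁ d₂ : ℕ
  V V₁ V₂ : Set

funToFin-cong : {f g : Fin m → Fin k} → f ≗ g → funToFin f ≡ funToFin g
funToFin-cong {zero}  f≗g = refl
funToFin-cong {suc m} f≗g = cong₂ combine (f≗g zero) (funToFin-cong (f≗g ∘ suc))

pointwise-injective⇒≤ : {A : Set} → A ↔ Fin k → 1 < k →
  (f : (Fin m → A) → (Fin d → A)) → (∀ u v → f u ≗ f v → u ≗ v) → m ≤ d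
pointwise-injective⇒≤ {k} {m} {d} {A} A↔Fin 1<k f f-injective =
  ≮⇒≥ λ d<m → <⇒≱ (^-monoʳ-< k 1<k d<m) (injective⇒≤ encode∘f∘decode-injective)
  where
  open Inverse A↔Fin using (to; from; strictlyInverseˡ; strictlyInverseʳ)

  encode : (Fin d → A) → Fin (k ^ d)
  encode v = funToFin (to ∘ v)

  decode : Fin (k ^ m) → (Fin m → A)
  decode i = from ∘ finToFun i

  encode-injective : ∀ u v → encode u ≡ encode v → u ≗ v
  encode-injective u v eq r = begin
    u r                          ≡⟨ strictlyInverseʳ (u r) ⟨
    from (to (u r))              ≡⟨ cong from (finToFun-funToFin (to ∘ u) r) ⟨
    from (finToFun (encode u) r) ≡⟨ cong (λ i → from (finToFun i r)) eq ⟩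
    from (finToFun (encode v) r) ≡⟨ cong from (finToFun-funToFin (to ∘ v) r) ⟩
    from (to (v r))              ≡⟨ strictlyInverseʳ (v r) ⟩
    v r                          ∎
    where open ≡-Reasoning

  decode-injective : ∀ i j → decode i ≗ decode j → i ≡ j
  decode-injective i j eq = begin
    i                             ≡⟨ funToFin-finToFin {m} {k} i ⟨
    funToFin (finToFun {k} {m} i) ≡⟨ funToFin-cong finToFun≗ ⟩
    funToFin (finToFun {k} {m} j) ≡⟨ funToFin-finToFin {m} {k} j ⟩
    j                             ∎
    where
    open ≡-Reasoning
    finToFun≗ : finToFun {k} {m} i ≗ finToFun j
    finToFun≗ r = trans (sym (strictlyInverseˡ _)) (trans (cong to (eq r)) (strictlyInverseˡ _))

  encode∘f∘decode-injective : Injective _≡_ _≡_ (encode ∘ f ∘ decode)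
  encode∘f∘decode-injective {i} {j} eq =
    decode-injective i j (f-injective _ _ (encode-injective _ _ eq))

Parity↔Fin2 : Parity ↔ Fin 2
Parity↔Fin2 = mk↔ₛ′ to from to∘from from∘to
  where
  to : Parity → Fin 2
  to 0ℙ = zero
  to 1ℙ = suc zero
  from : Fin 2 → Parity
  from zero       = 0ℙ
  from (suc zero) = 1ℙ
  to∘from : ∀ i → to (from i) ≡ i
  to∘from zero       = refl
  to∘from (suc zero) = refl
  from∘to : ∀ p → from (to p) ≡ p
  from∘to 0ℙ = refl
  from∘to 1ℙ = refl

δ : Fin m → Fin m → Parity
δ j k = if does (j ≟ k) then 1ℙ else 0ℙ

δ-refl : (j : Fin m) → δ j j ≡ 1ℙ
δ-refl j = cong (if_then 1ℙ else 0ℙ) (dec-true (j ≟ j) refl)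

δ-comm : (j k : Fin m) → δ j k ≡ δ k j
δ-comm j k = cong (if_then 1ℙ else 0ℙ) (does-⇔ (mk⇔ sym sym) (j ≟ k) (k ≟ j))

∑-δ : (j : Fin m) (c : Vector Parity m) → ∑[ k < m ] (δ j k · c k) ≡ c j
∑-δ {suc m} zero    c = trans (cong (c zero ⊕_) (sum-replicate-zero m)) (ℙ.+-identityʳ (c zero))
∑-δ {suc m} (suc j) c = ∑-δ j (c ∘ suc)

infix 7 _∙_

_∙_ : Vector Parity d → Vector Parity d → Parity
_∙_ {d} u v = ∑[ r < d ] (u r · v r)

∑-↑ : (F : Vector Parity (d₁ + d₂)) →
  sum F ≡ ∑[ r < d₁ ] F (r ↑ˡ d₂) ⊕ ∑[ r < d₂ ] F (d₁ ↑ʳ r)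
∑-↑ {zero}   F = refl
∑-↑ {suc d₁} {d₂} F =
  trans (cong (F zero ⊕_) (∑-↑ {d₁} {d₂} (F ∘ suc))) (sym (ℙ.+-assoc (F zero) _ _))

∙-++ : (u₁ v₁ : Vector Parity d₁) (u₂ v₂ : Vector Parity d₂) →
  (u₁ ++ u₂) ∙ (v₁ ++ v₂) ≡ u₁ ∙ v₁ ⊕ u₂ ∙ v₂
∙-++ {d₁} {d₂} u₁ v₁ u₂ v₂ = trans (∑-↑ {d₁} {d₂} _) (cong₂ _⊕_
  (sum-cong-≗ λ r → cong₂ _·_ (lookup-++ˡ u₁ u₂ r) (lookup-++ˡ v₁ v₂ r))
  (sum-cong-≗ λ r → cong₂ _·_ (lookup-++ʳ u₁ u₂ r) (lookup-++ʳ v₁ v₂ r)))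

biorthogonal⇒≤ : (u v : Fin m → Vector Parity d) → (∀ j k → u j ∙ v k ≡ δ j k) → m ≤ d
biorthogonal⇒≤ {m} {d} u v u∙v≡δ =
  pointwise-injective⇒≤ Parity↔Fin2 (s≤s (s≤s z≤n)) combination combination-injective
  where
  open ≡-Reasoning

  combination : Vector Parity m → Vector Parity d
  combination c r = ∑[ k < m ] (v k r · c k)

  coefficient : ∀ c j → u j ∙ combination c ≡ c j
  coefficient c j = begin
    ∑[ r < d ] (u j r · ∑[ k < m ] (v k r · c k))  ≡⟨ sum-cong-≗ (λ r → *-distribˡ-sum (u j r) (λ k → v k r · c k)) ⟩
    ∑[ r < d ] ∑[ k < m ] (u j r · (v k r · c k))  ≡⟨ ∑-comm (λ r k → u j r · (v k r · c k)) ⟩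
    ∑[ k < m ] ∑[ r < d ] (u j r · (v k r · c k))  ≡⟨ sum-cong-≗ (λ k → sum-cong-≗ (λ r → ℙ.*-assoc (u j r) (v k r) (c k))) ⟨
    ∑[ k < m ] ∑[ r < d ] (u j r · v k r · c k)    ≡⟨ sum-cong-≗ (λ k → *-distribʳ-sum (c k) (λ r → u j r · v k r)) ⟨
    ∑[ k < m ] ((u j ∙ v k) · c k)                 ≡⟨ sum-cong-≗ (λ k → cong (_· c k) (u∙v≡δ j k)) ⟩
    ∑[ k < m ] (δ j k · c k)                       ≡⟨ ∑-δ j c ⟩
    c j                                            ∎

  combination-injective : ∀ c c′ → combination c ≗ combination c′ → c ≗ c′
  combination-injective c c′ eq j = begin
    c j                      ≡⟨ coefficient c j ⟨
    u j ∙ combination c      ≡⟨ sum-cong-≗ (λ r → cong (u j r ·_) (eq r)) ⟩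
    u j ∙ combination c′     ≡⟨ coefficient c′ j ⟩
    c′ j                     ∎

-- Keeping the offset out of the inner product lets offsets add up under xor-products
-- without costing a dimension; this is what saves the ℓ - 1 in the bound.
record AffineFactorisation {V : Set} (d : ℕ) (K : V → V → Parity) : Set where
  field
    offset      : V → Parity
    left right  : V → Vector Parity d
    factorises  : ∀ g h → K g h ≡ offset g ⊕ left g ∙ right h

≡δ⁻¹⇒≤ : {K : V → V → Parity} → AffineFactorisation d K →
  (x : Fin m → V) → (∀ j k → K (x j) (x k) ≡ δ j k ⁻¹) → m ≤ suc d
≡δ⁻¹⇒≤ {d = d} {m = m} {K = K} F x K≡δ⁻¹ = biorthogonal⇒≤ u v u∙v≡δ
  where
  open AffineFactorisation F
  open ≡-Reasoning

  u v : Fin m → Vector Parity (suc d)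
  u j = offset (x j) ⁻¹ ∷ left (x j)
  v k = 1ℙ ∷ right (x k)

  u∙v≡δ : ∀ j k → u j ∙ v k ≡ δ j k
  u∙v≡δ j k = begin
    offset (x j) ⁻¹ · 1ℙ ⊕ left (x j) ∙ right (x k)  ≡⟨ cong (_⊕ left (x j) ∙ right (x k)) (ℙ.*-identityʳ (offset (x j) ⁻¹)) ⟩
    1ℙ ⊕ offset (x j) ⊕ left (x j) ∙ right (x k)     ≡⟨ ℙ.+-assoc 1ℙ (offset (x j)) (left (x j) ∙ right (x k)) ⟩
    (offset (x j) ⊕ left (x j) ∙ right (x k)) ⁻¹     ≡⟨ cong _⁻¹ (factorises (x j) (x k)) ⟨
    K (x j) (x k) ⁻¹                                 ≡⟨ cong _⁻¹ (K≡δ⁻¹ j k) ⟩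
    δ j k ⁻¹ ⁻¹                                      ≡⟨ ℙ.⁻¹-involutive (δ j k) ⟩
    δ j k                                            ∎

-- [a ≢ b] = [a ≢ 0] + Σᵣ left a r · [b ≡ 1 + r]: for a = 0 the sum is [b ≢ 0], and for
-- a = 1 + a′ it is [b ≡ a].
δ⁻¹-factorisation : ∀ n → AffineFactorisation (n ∸ 1) (λ (a b : Fin n) → δ a b ⁻¹)
δ⁻¹-factorisation zero    = record { offset = λ () ; left = λ () ; right = λ () ; factorises = λ () }
δ⁻¹-factorisation (suc n) = record
  { offset = offset ; left = left ; right = right ; factorises = factorises }
  where
  offset : Fin (suc n) → Parity
  offset zero    = 0ℙ
  offset (suc _) = 1ℙ

  left right : Fin (suc n) → Vector Parity n
  left zero    _ = 1ℙ
  left (suc a)   = δ a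
  right b r = δ b (suc r)

  factorises : ∀ a b → δ a b ⁻¹ ≡ offset a ⊕ left a ∙ right b
  factorises zero    zero    = sym (sum-replicate-zero n)
  factorises zero    (suc b) =
    sym (trans (sum-cong-≗ (λ r → sym (ℙ.*-identityʳ (δ b r)))) (∑-δ b (λ _ → 1ℙ)))
  factorises (suc a) b       =
    cong _⁻¹ (trans (δ-comm (suc a) b) (sym (∑-δ a (λ r → δ b (suc r)))))

xor-product : {K₁ : V₁ → V₁ → Parity} {K₂ : V₂ → V₂ → Parity} {K : V → V → Parity} →
  AffineFactorisation d₁ K₁ → AffineFactorisation d₂ K₂ → (p₁ : V → V₁) (p₂ : V → V₂) →
  (∀ g h → K g h ≡ K₁ (p₁ g) (p₁ h) ⊕ K₂ (p₂ g) (p₂ h)) → AffineFactorisation (d₁ + d₂) K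
xor-product {d₁ = d₁} {d₂ = d₂} {K₁ = K₁} {K₂} {K} F₁ F₂ p₁ p₂ K≡K₁⊕K₂ = record
  { offset     = λ g → o₁ (p₁ g) ⊕ o₂ (p₂ g)
  ; left       = λ g → l₁ (p₁ g) ++ l₂ (p₂ g)
  ; right      = λ h → r₁ (p₁ h) ++ r₂ (p₂ h)
  ; factorises = factorises
  }
  where
  open AffineFactorisation F₁ renaming (offset to o₁; left to l₁; right to r₁; factorises to f₁)
  open AffineFactorisation F₂ renaming (offset to o₂; left to l₂; right to r₂; factorises to f₂)
  open ≡-Reasoning

  factorises : ∀ g h → K g h ≡ o₁ (p₁ g) ⊕ o₂ (p₂ g) ⊕ (l₁ (p₁ g) ++ l₂ (p₂ g)) ∙ (r₁ (p₁ h) ++ r₂ (p₂ h))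
  factorises g h = begin
    K g h                                ≡⟨ K≡K₁⊕K₂ g h ⟩
    K₁ (p₁ g) (p₁ h) ⊕ K₂ (p₂ g) (p₂ h)  ≡⟨ cong₂ _⊕_ (f₁ (p₁ g) (p₁ h)) (f₂ (p₂ g) (p₂ h)) ⟩
    (c₁ ⊕ u₁ ∙ v₁) ⊕ (c₂ ⊕ u₂ ∙ v₂)      ≡⟨ interchange c₁ (u₁ ∙ v₁) c₂ (u₂ ∙ v₂) ⟩
    c₁ ⊕ c₂ ⊕ (u₁ ∙ v₁ ⊕ u₂ ∙ v₂)        ≡⟨ cong (c₁ ⊕ c₂ ⊕_) (∙-++ u₁ v₁ u₂ v₂) ⟨
    c₁ ⊕ c₂ ⊕ (u₁ ++ u₂) ∙ (v₁ ++ v₂)    ∎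
    where
    c₁ c₂ : Parity
    u₁ v₁ : Vector Parity d₁
    u₂ v₂ : Vector Parity d₂
    c₁ = o₁ (p₁ g)
    c₂ = o₂ (p₂ g)
    u₁ = l₁ (p₁ g)
    u₂ = l₂ (p₂ g)
    v₁ = r₁ (p₁ h)
    v₂ = r₂ (p₂ h)

allPairs-lookup : {A : Set} {R : Rel A 0ℓ} → Symmetric R → {xs : List A} → AllPairs R xs →
  {j k : Fin (length xs)} → ¬ j ≡ k → R (lookup xs j) (lookup xs k)
allPairs-lookup R-sym (Rx AllPairs.∷ _)   {zero}  {zero}  j≢k = contradiction refl j≢k
allPairs-lookup R-sym (Rx AllPairs.∷ _)   {zero}  {suc k} _   = All.lookup Rx (∈-lookup k)
allPairs-lookup R-sym (Rx AllPairs.∷ _)   {suc j} {zero}  _   = R-sym (All.lookup Rx (∈-lookup j))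
allPairs-lookup R-sym (_ AllPairs.∷ Rxs) {suc j} {suc k} j≢k = allPairs-lookup R-sym Rxs (j≢k ∘ cong suc)

adjacency : (ℓ : ℕ) (n : Fin ℓ → ℕ) → Vertex ℓ n → Vertex ℓ n → Parity
adjacency ℓ n g h = parity (diffCount ℓ n g h)

parity-if : ∀ b → parity (if b then 0 else 1) ≡ (if b then 1ℙ else 0ℙ) ⁻¹
parity-if true  = refl
parity-if false = refl

adjacency-suc : ∀ ℓ n (g h : Vertex (suc ℓ) n) → adjacency (suc ℓ) n g h ≡
  δ (g zero) (h zero) ⁻¹ ⊕ adjacency ℓ (λ i → n (suc i)) (λ i → g (suc i)) (λ i → h (suc i))
adjacency-suc ℓ n g h =
  trans (ℙ.+-homo-+ (if g₀≟h₀ then 0 else 1) rest) (cong (_⊕ parity rest) (parity-if g₀≟h₀))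
  where
  g₀≟h₀ : Bool
  g₀≟h₀ = does (g zero ≟ h zero)
  rest : ℕ
  rest = diffCount ℓ (λ i → n (suc i)) (λ i → g (suc i)) (λ i → h (suc i))

adjacency-refl : ∀ ℓ n (g : Vertex ℓ n) → adjacency ℓ n g g ≡ 0ℙ
adjacency-refl zero    n g = refl
adjacency-refl (suc ℓ) n g = trans (adjacency-suc ℓ n g g)
  (cong₂ _⊕_ (cong _⁻¹ (δ-refl (g zero))) (adjacency-refl ℓ (λ i → n (suc i)) (λ i → g (suc i))))

adjacency-sym : ∀ ℓ n (g h : Vertex ℓ n) → adjacency ℓ n g h ≡ adjacency ℓ n h g
adjacency-sym zero    n g h = refl
adjacency-sym (suc ℓ) n g h = begin
  adjacency (suc ℓ) n g h                                        ≡⟨ adjacency-suc ℓ n g h ⟩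
  δ (g zero) (h zero) ⁻¹ ⊕ adjacency ℓ n′ (tail g) (tail h)      ≡⟨ cong₂ _⊕_ (cong _⁻¹ (δ-comm (g zero) (h zero)))
                                                                            (adjacency-sym ℓ n′ (tail g) (tail h)) ⟩
  δ (h zero) (g zero) ⁻¹ ⊕ adjacency ℓ n′ (tail h) (tail g)      ≡⟨ adjacency-suc ℓ n h g ⟨
  adjacency (suc ℓ) n h g                                        ∎
  where
  open ≡-Reasoning
  n′ : Fin ℓ → ℕ
  n′ i = n (suc i)
  tail : Vertex (suc ℓ) n → Vertex ℓ n′
  tail g i = g (suc i)

%2≡1⇒parity≡1ℙ : ∀ k → k % 2 ≡ 1 → parity k ≡ 1ℙ
%2≡1⇒parity≡1ℙ (suc zero)    _ = refl
%2≡1⇒parity≡1ℙ (suc (suc k)) k%2≡1 = %2≡1⇒parity≡1ℙ k k%2≡1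

adjacency-factorisation : ∀ ℓ n → AffineFactorisation (sumFin ℓ (λ i → n i ∸ 1)) (adjacency ℓ n)
adjacency-factorisation zero    n = record
  { offset = λ _ → 0ℙ ; left = λ _ → [] ; right = λ _ → [] ; factorises = λ _ _ → refl }
adjacency-factorisation (suc ℓ) n =
  xor-product (δ⁻¹-factorisation (n zero)) (adjacency-factorisation ℓ (λ i → n (suc i)))
    (λ g → g zero) (λ g i → g (suc i)) (adjacency-suc ℓ n)

clique-adjacency : ∀ ℓ n {xs : List (Vertex ℓ n)} → IsClique ℓ n xs →
  ∀ j k → adjacency ℓ n (lookup xs j) (lookup xs k) ≡ δ j k ⁻¹
clique-adjacency ℓ n {xs} clique j k with j ≟ k
... | yes refl = adjacency-refl ℓ n (lookup xs j)
... | no j≢k   = allPairs-lookup (λ {g} {h} → trans (adjacency-sym ℓ n h g))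
                   (AllPairs.map (λ {g} {h} (_ , odd) → %2≡1⇒parity≡1ℙ (diffCount ℓ n g h) odd) clique) j≢k

sumFin-∸1 : ∀ ℓ (n : Fin ℓ → ℕ) → (∀ i → 1 ≤ n i) → sumFin ℓ (λ i → n i ∸ 1) + ℓ ≡ sumFin ℓ n
sumFin-∸1 zero    n 1≤n = refl
sumFin-∸1 (suc ℓ) n 1≤n = begin
  n zero ∸ 1 + S + suc ℓ      ≡⟨ +-suc (n zero ∸ 1 + S) ℓ ⟩
  suc (n zero ∸ 1 + S + ℓ)    ≡⟨ cong suc (+-assoc (n zero ∸ 1) S ℓ) ⟩
  suc (n zero ∸ 1 + (S + ℓ))  ≡⟨ cong (λ t → suc (n zero ∸ 1 + t)) (sumFin-∸1 ℓ (λ i → n (suc i)) (1≤n ∘ suc)) ⟩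
  suc (n zero ∸ 1) + T        ≡⟨ cong (_+ T) (trans (+-comm 1 (n zero ∸ 1)) (m∸n+n≡m (1≤n zero))) ⟩
  n zero + T                  ∎
  where
  open ≡-Reasoning
  S T : ℕ
  S = sumFin ℓ (λ i → n (suc i) ∸ 1)
  T = sumFin ℓ (λ i → n (suc i))

-- The bound holds for every ℓ.
theorem3p1 : (ℓ : ℕ) → ℓ ≥ 2 → (n : Fin ℓ → ℕ) → ((i : Fin ℓ) → 1 ≤ n i) →
    (xs : List (Vertex ℓ n)) → IsClique ℓ n xs →
      length xs ≤ sumFin ℓ n ∸ ℓ + 1
theorem3p1 ℓ _ n 1≤n xs clique = subst (length xs ≤_) bound≡
  (≡δ⁻¹⇒≤ (adjacency-factorisation ℓ n) (lookup xs) (clique-adjacency ℓ n clique))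
  where
  open ≡-Reasoning
  S : ℕ
  S = sumFin ℓ (λ i → n i ∸ 1)
  bound≡ : suc S ≡ sumFin ℓ n ∸ ℓ + 1
  bound≡ = begin
    suc S              ≡⟨ +-comm 1 S ⟩
    S + 1              ≡⟨ cong (_+ 1) (m+n∸n≡m S ℓ) ⟨
    S + ℓ ∸ ℓ + 1      ≡⟨ cong (λ t → t ∸ ℓ + 1) (sumFin-∸1 ℓ n 1≤n) ⟩
    sumFin ℓ n ∸ ℓ + 1 ∎
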